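{- Let $m(n)$ denote the largest possible number of triangles having minimum area formed by $n$ lines in the Euclidean plane, and suppose $n\geq 3$. Then $$m(n)\geq \begin{cases} 6l^2+2jl-2 & \text{if } n=6l+j,\ j\in\{0,\pm1,\pm2\},\\ 6l^2+6l & \text{if } n=6l+3.\end{cases}$$
   Context: A triangle formed by a set of lines is a triangle whose three sides lie on three distinct lines of the set (a triple of pairwise non-parallel, non-concurrent lines). For an arrangement of $n$ distinct lines, count the triples forming a triangle whose area equals the minimum area among all triangles formed by the arrangement; $m(n)$ is the maximum of this count over all arrangements of $n$ lines. Here $l$ is an integer. -}

module Defs where

open import Data.Rational as Q using (ℚ; 0ℚ; _≟_; ∣_∣; _÷_; ≢-nonZero)
open import Data.Nat using (ℕ)
open import Data.Integer as Z using (ℤ; +_)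
open import Data.Fin as F using (Fin)
open import Data.Product using (Σ; ∃; _×_; _,_; proj₁; proj₂)
open import Data.List using (List; length)
open import Data.List.Relation.Unary.All using (All)
open import Data.List.Relation.Unary.Unique.Propositional using (Unique)
open import Relation.Binary.PropositionalEquality using (_≡_; _≢_)
open import Relation.Nullary using (¬_; yes; no)

record Line : Set where
  constructor line
  field
    a b c : ℚ
    nondeg : ¬ (a ≡ 0ℚ × b ≡ 0ℚ)
open Line public

Point : Set
Point = ℚ × ℚ

OnLine : Point → Line → Set
OnLine (x , y) l = a l Q.* x Q.+ b l Q.* y ≡ c l

SameLine : Line → Line → Set
SameLine l m = Σ ℚ λ t → t ≢ 0ℚ × a m ≡ t Q.* a l × b m ≡ t Q.* b l × c m ≡ t Q.* c l

-- Parallel (or equal): direction vectors are proportional.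
Parallel : Line → Line → Set
Parallel l m = a l Q.* b m ≡ a m Q.* b l

-- Division, only used with nonzero divisor (returns 0 otherwise).
_/'_ : ℚ → ℚ → ℚ
p /' q with q ≟ 0ℚ
... | yes _ = 0ℚ
... | no q≢0 = _÷_ p q {{≢-nonZero q≢0}}

-- Intersection point of two non-parallel lines (Cramer's rule).
meet : Line → Line → Point
meet l m =
  ((c l Q.* b m Q.- c m Q.* b l) /' d) , ((a l Q.* c m Q.- a m Q.* c l) /' d)
  where d = a l Q.* b m Q.- a m Q.* b l

FormsTriangle : Line → Line → Line → Set
FormsTriangle l₁ l₂ l₃ =
  ¬ Parallel l₁ l₂ × ¬ Parallel l₂ l₃ × ¬ Parallel l₁ l₃ × ¬ OnLine (meet l₁ l₂) l₃

-- Area of the triangle with given vertices (shoelace formula).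
triArea : Point → Point → Point → ℚ
triArea (x₁ , y₁) (x₂ , y₂) (x₃ , y₃) =
  ∣ (x₂ Q.- x₁) Q.* (y₃ Q.- y₁) Q.- (x₃ Q.- x₁) Q.* (y₂ Q.- y₁) ∣ Q.* Q.½

area : Line → Line → Line → ℚ
area l₁ l₂ l₃ = triArea (meet l₁ l₂) (meet l₂ l₃) (meet l₁ l₃)

Arrangement : ℕ → Set
Arrangement n = Fin n → Line

Distinct : ∀ {n} → Arrangement n → Set
Distinct {n} L = (i j : Fin n) → i ≢ j → ¬ SameLine (L i) (L j)

Triple : ℕ → Set
Triple n = Fin n × Fin n × Fin n

Increasing : ∀ {n} → Triple n → Set
Increasing (i , j , k) = i F.< j × j F.< k

IsTriangle : ∀ {n} → Arrangement n → Triple n → Set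
IsTriangle L (i , j , k) = FormsTriangle (L i) (L j) (L k)

triangleArea : ∀ {n} → Arrangement n → Triple n → ℚ
triangleArea L (i , j , k) = area (L i) (L j) (L k)

IsMinTriangle : ∀ {n} → Arrangement n → Triple n → Set
IsMinTriangle {n} L t =
  Increasing t × IsTriangle L t ×
  ((s : Triple n) → Increasing s → IsTriangle L s → triangleArea L t Q.≤ triangleArea L s)

AtLeastMinTriangles : ∀ {n} → Arrangement n → ℤ → Set
AtLeastMinTriangles L N =
  Σ (List (Triple _)) λ ts → Unique ts × All (IsMinTriangle L) ts × N Z.≤ + length ts

m≥ : ℕ → ℤ → Set
m≥ n N = Σ (Arrangement n) λ L → Distinct L × AtLeastMinTriangles L N

-- Take the n = A + B + C lines x = p (p < A), y = q (q < B) and x + y = s − r (r < C). Three of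
-- them bound a triangle only if they come one from each family, and then the triangle has area
-- d²/2 with d = ∣s − (p + q + r)∣ a nonzero integer. So the minimum area is ½, attained exactly
-- at the lattice cells (p, q, r) of the box A × B × C with p + q + r = s ± 1. The hexagonal box
-- A = B = C = 2l + 1, s = 3l has 6l² + 6l such cells. Adding one line at a time, alternately at
-- the low and the high end of a family and cycling through the three families, each new line
-- contributes two full antidiagonals of the opposite face of the box; six such steps give the
-- counts for n = 6l + 4, …, 6l + 8 and lead to the next hexagon. For l = 0 the box is too small
-- for this pattern, and the cells are counted exhaustively.
module Submission where

open import Defs
open import Data.Nat using (ℕ)
open import Data.Product using (_×_; _,_)
open import Relation.Binary.PropositionalEquality

module Lattice where

  open import Data.Nat as ℕ using (zero; suc; ∣_-_∣)
  import Data.Nat.Properties as ℕ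
  open import Data.Rational as ℚ using (ℚ; 0ℚ; 1ℚ; ½)
  import Data.Rational.Properties as ℚ
  open import Data.Rational.Solver using (module +-*-Solver)
  open import Algebra.Properties.Group ℚ.+-0-group using (∙-cancelˡ)
  open import Relation.Nullary using (¬_; contradiction)
  open +-*-Solver

  fromℕ : ℕ → ℚ
  fromℕ zero    = 0ℚ
  fromℕ (suc n) = 1ℚ ℚ.+ fromℕ n

  fromℕ-+ : ∀ m n → fromℕ (m ℕ.+ n) ≡ fromℕ m ℚ.+ fromℕ n
  fromℕ-+ zero    n = sym (ℚ.+-identityˡ (fromℕ n))
  fromℕ-+ (suc m) n = trans (cong (1ℚ ℚ.+_) (fromℕ-+ m n)) (sym (ℚ.+-assoc 1ℚ (fromℕ m) (fromℕ n)))

  fromℕ-* : ∀ m n → fromℕ (m ℕ.* n) ≡ fromℕ m ℚ.* fromℕ n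
  fromℕ-* zero    n = sym (ℚ.*-zeroˡ (fromℕ n))
  fromℕ-* (suc m) n = begin
    fromℕ (n ℕ.+ m ℕ.* n)            ≡⟨ fromℕ-+ n (m ℕ.* n) ⟩
    fromℕ n ℚ.+ fromℕ (m ℕ.* n)      ≡⟨ cong (fromℕ n ℚ.+_) (fromℕ-* m n) ⟩
    fromℕ n ℚ.+ fromℕ m ℚ.* fromℕ n  ≡⟨ solve 2 (λ x y → y :+ x :* y := (con 1ℚ :+ x) :* y) refl (fromℕ m) (fromℕ n) ⟩
    (1ℚ ℚ.+ fromℕ m) ℚ.* fromℕ n     ∎
    where open ≡-Reasoning

  fromℕ-+³ : ∀ p q r → fromℕ (p ℕ.+ q ℕ.+ r) ≡ fromℕ p ℚ.+ fromℕ q ℚ.+ fromℕ r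
  fromℕ-+³ p q r = trans (fromℕ-+ (p ℕ.+ q) r) (cong (ℚ._+ fromℕ r) (fromℕ-+ p q))

  0≤fromℕ : ∀ n → 0ℚ ℚ.≤ fromℕ n
  0≤fromℕ zero    = ℚ.≤-refl
  0≤fromℕ (suc n) = ℚ.+-mono-≤ {0ℚ} {1ℚ} (ℚ.<⇒≤ (ℚ.positive⁻¹ 1ℚ)) (0≤fromℕ n)

  1≤fromℕ-suc : ∀ n → 1ℚ ℚ.≤ fromℕ (suc n)
  1≤fromℕ-suc n = ℚ.+-monoʳ-≤ 1ℚ (0≤fromℕ n)

  fromℕ-suc≢0 : ∀ n → fromℕ (suc n) ≢ 0ℚ
  fromℕ-suc≢0 n eq = ℚ.<⇒≢ (ℚ.<-≤-trans (ℚ.positive⁻¹ 1ℚ) (1≤fromℕ-suc n)) (sym eq)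

  fromℕ-injective : ∀ {m n} → fromℕ m ≡ fromℕ n → m ≡ n
  fromℕ-injective {zero}  {zero}  _  = refl
  fromℕ-injective {zero}  {suc n} eq = contradiction (sym eq) (fromℕ-suc≢0 n)
  fromℕ-injective {suc m} {zero}  eq = contradiction eq (fromℕ-suc≢0 m)
  fromℕ-injective {suc m} {suc n} eq = cong suc (fromℕ-injective (∙-cancelˡ 1ℚ (fromℕ m) (fromℕ n) eq))

  fromℕ-difference² : ∀ m n → let d = fromℕ m ℚ.- fromℕ n in d ℚ.* d ≡ fromℕ (∣ m - n ∣ ℕ.* ∣ m - n ∣)
  fromℕ-difference² zero    zero    = refl
  fromℕ-difference² zero    (suc n) = trans
    (solve 1 (λ x → (con 0ℚ :- x) :* (con 0ℚ :- x) := x :* x) refl (fromℕ (suc n)))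
    (sym (fromℕ-* (suc n) (suc n)))
  fromℕ-difference² (suc m) zero    = trans
    (solve 1 (λ x → (x :- con 0ℚ) :* (x :- con 0ℚ) := x :* x) refl (fromℕ (suc m)))
    (sym (fromℕ-* (suc m) (suc m)))
  fromℕ-difference² (suc m) (suc n) = trans
    (solve 2 (λ x y → ((con 1ℚ :+ x) :- (con 1ℚ :+ y)) :* ((con 1ℚ :+ x) :- (con 1ℚ :+ y)) := (x :- y) :* (x :- y))
       refl (fromℕ m) (fromℕ n))
    (fromℕ-difference² m n)

  vertical horizontal antidiagonal : ℚ → Line
  vertical     c = line 1ℚ 0ℚ c λ { (() , _) }
  horizontal   c = line 0ℚ 1ℚ c λ { (_ , ()) }
  antidiagonal c = line 1ℚ 1ℚ c λ { (() , _) }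

  same-line⇒parallel : ∀ l m → SameLine l m → Parallel l m
  same-line⇒parallel l m (t , _ , a≡ , b≡ , _) = begin
    a l ℚ.* b m          ≡⟨ cong (a l ℚ.*_) b≡ ⟩
    a l ℚ.* (t ℚ.* b l)  ≡⟨ solve 3 (λ x y t → x :* (t :* y) := (t :* x) :* y) refl (a l) (b l) t ⟩
    t ℚ.* a l ℚ.* b l    ≡⟨ cong (ℚ._* b l) (sym a≡) ⟩
    a m ℚ.* b l          ∎
    where open ≡-Reasoning

  unscaled-offset : ∀ t {c c′} → 1ℚ ≡ t ℚ.* 1ℚ → c′ ≡ t ℚ.* c → c′ ≡ c
  unscaled-offset t {c} 1≡t eq = trans eq (trans (cong (ℚ._* c) (sym (trans 1≡t (ℚ.*-identityʳ t)))) (ℚ.*-identityˡ c))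

  meet-vertical-horizontal : ∀ a b → meet (vertical a) (horizontal b) ≡ (a , b)
  meet-vertical-horizontal a b = cong₂ _,_
    (solve 2 (λ a b → (a :* con 1ℚ :- b :* con 0ℚ) :* con 1ℚ := a) refl a b)
    (solve 2 (λ a b → (con 1ℚ :* b :- con 0ℚ :* a) :* con 1ℚ := b) refl a b)

  concurrent⇒ : ∀ a b c → OnLine (meet (vertical a) (horizontal b)) (antidiagonal c) → a ℚ.+ b ≡ c
  concurrent⇒ a b c on = trans (solve 2 (λ a b → a :+ b := con 1ℚ :* a :+ con 1ℚ :* b) refl a b)
    (subst (λ P → OnLine P (antidiagonal c)) (meet-vertical-horizontal a b) on)

  concurrent⇐ : ∀ a b c → a ℚ.+ b ≡ c → OnLine (meet (vertical a) (horizontal b)) (antidiagonal c)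
  concurrent⇐ a b c eq = subst (λ P → OnLine P (antidiagonal c)) (sym (meet-vertical-horizontal a b))
    (trans (solve 2 (λ a b → con 1ℚ :* a :+ con 1ℚ :* b := a :+ b) refl a b) eq)

  -- The left-hand side of the solved identity is `area` unfolded: Cramer's rule for the three
  -- vertices, then the shoelace formula.
  area-vertical-horizontal-antidiagonal : ∀ a b c → let d = c ℚ.- a ℚ.- b in
    area (vertical a) (horizontal b) (antidiagonal c) ≡ ℚ.∣ d ℚ.* d ∣ ℚ.* ½
  area-vertical-horizontal-antidiagonal a b c = cong (λ e → ℚ.∣ e ∣ ℚ.* ½)
    (solve 3 (λ a b c →
       (((b :* con 1ℚ :- c :* con 1ℚ) :* con (ℚ.- 1ℚ)) :- (a :* con 1ℚ :- b :* con 0ℚ) :* con 1ℚ)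
         :* (((con 1ℚ :* c :- con 1ℚ :* a) :* con 1ℚ) :- (con 1ℚ :* b :- con 0ℚ :* a) :* con 1ℚ)
       :- (((a :* con 1ℚ :- c :* con 0ℚ) :* con 1ℚ) :- (a :* con 1ℚ :- b :* con 0ℚ) :* con 1ℚ)
         :* (((con 0ℚ :* c :- con 1ℚ :* b) :* con (ℚ.- 1ℚ)) :- (con 1ℚ :* b :- con 0ℚ :* a) :* con 1ℚ)
       := (c :- a :- b) :* (c :- a :- b)) refl a b c)

  xLine yLine : ℕ → Line
  xLine p = vertical (fromℕ p)
  yLine q = horizontal (fromℕ q)

  zLine : ℕ → ℕ → Line
  zLine s r = antidiagonal (fromℕ s ℚ.- fromℕ r)

  xLine-injective : ∀ {p p′} → SameLine (xLine p) (xLine p′) → p ≡ p′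
  xLine-injective (t , _ , a≡ , _ , c≡) = sym (fromℕ-injective (unscaled-offset t a≡ c≡))

  yLine-injective : ∀ {q q′} → SameLine (yLine q) (yLine q′) → q ≡ q′
  yLine-injective (t , _ , _ , b≡ , c≡) = sym (fromℕ-injective (unscaled-offset t b≡ c≡))

  zLine-injective : ∀ {s r r′} → SameLine (zLine s r) (zLine s r′) → r ≡ r′
  zLine-injective {s} (t , _ , a≡ , _ , c≡) =
    sym (fromℕ-injective (ℚ.neg-injective (∙-cancelˡ (fromℕ s) _ _ (unscaled-offset t a≡ c≡))))

  lattice-concurrent⇒ : ∀ s p q r → OnLine (meet (xLine p) (yLine q)) (zLine s r) → p ℕ.+ q ℕ.+ r ≡ s
  lattice-concurrent⇒ s p q r on = fromℕ-injective (begin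
    fromℕ (p ℕ.+ q ℕ.+ r)             ≡⟨ fromℕ-+³ p q r ⟩
    fromℕ p ℚ.+ fromℕ q ℚ.+ fromℕ r   ≡⟨ cong (ℚ._+ fromℕ r) (concurrent⇒ (fromℕ p) (fromℕ q) (fromℕ s ℚ.- fromℕ r) on) ⟩
    fromℕ s ℚ.- fromℕ r ℚ.+ fromℕ r   ≡⟨ solve 2 (λ x y → x :- y :+ y := x) refl (fromℕ s) (fromℕ r) ⟩
    fromℕ s                           ∎)
    where open ≡-Reasoning

  lattice-concurrent⇐ : ∀ s p q r → p ℕ.+ q ℕ.+ r ≡ s → OnLine (meet (xLine p) (yLine q)) (zLine s r)
  lattice-concurrent⇐ s p q r refl = concurrent⇐ (fromℕ p) (fromℕ q) (fromℕ (p ℕ.+ q ℕ.+ r) ℚ.- fromℕ r) (begin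
    fromℕ p ℚ.+ fromℕ q                           ≡⟨ solve 3 (λ x y z → x :+ y := x :+ y :+ z :- z) refl (fromℕ p) (fromℕ q) (fromℕ r) ⟩
    fromℕ p ℚ.+ fromℕ q ℚ.+ fromℕ r ℚ.- fromℕ r   ≡⟨ cong (ℚ._- fromℕ r) (sym (fromℕ-+³ p q r)) ⟩
    fromℕ (p ℕ.+ q ℕ.+ r) ℚ.- fromℕ r             ∎)
    where open ≡-Reasoning

  lattice-area : ∀ s p q r → let d = ∣ s - p ℕ.+ q ℕ.+ r ∣ in
    area (xLine p) (yLine q) (zLine s r) ≡ fromℕ (d ℕ.* d) ℚ.* ½
  lattice-area s p q r = begin
    area (xLine p) (yLine q) (zLine s r)  ≡⟨ area-vertical-horizontal-antidiagonal (fromℕ p) (fromℕ q) (fromℕ s ℚ.- fromℕ r) ⟩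
    ℚ.∣ e ℚ.* e ∣ ℚ.* ½                   ≡⟨ cong (λ x → ℚ.∣ x ℚ.* x ∣ ℚ.* ½) e≡d ⟩
    ℚ.∣ d ℚ.* d ∣ ℚ.* ½                   ≡⟨ cong (λ x → ℚ.∣ x ∣ ℚ.* ½) (fromℕ-difference² s t) ⟩
    ℚ.∣ fromℕ (δ ℕ.* δ) ∣ ℚ.* ½           ≡⟨ cong (ℚ._* ½) (ℚ.0≤p⇒∣p∣≡p (0≤fromℕ (δ ℕ.* δ))) ⟩
    fromℕ (δ ℕ.* δ) ℚ.* ½                 ∎
    where
    open ≡-Reasoning
    t = p ℕ.+ q ℕ.+ r
    δ = ∣ s - t ∣
    e = fromℕ s ℚ.- fromℕ r ℚ.- fromℕ p ℚ.- fromℕ q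
    d = fromℕ s ℚ.- fromℕ t
    e≡d : e ≡ d
    e≡d = trans
      (solve 4 (λ s p q r → s :- r :- p :- q := s :- (p :+ q :+ r)) refl (fromℕ s) (fromℕ p) (fromℕ q) (fromℕ r))
                (cong (λ x → fromℕ s ℚ.- x) (sym (fromℕ-+³ p q r)))

  unit-triangle : ∀ s p q r → ∣ s - p ℕ.+ q ℕ.+ r ∣ ≡ 1 →
    FormsTriangle (xLine p) (yLine q) (zLine s r) × area (xLine p) (yLine q) (zLine s r) ≡ ½
  unit-triangle s p q r d≡1 =
    ((λ ()) , (λ ()) , (λ ()) , not-concurrent) , trans (lattice-area s p q r) (cong (λ d → fromℕ (d ℕ.* d) ℚ.* ½) d≡1)
    where
    not-concurrent : ¬ OnLine (meet (xLine p) (yLine q)) (zLine s r)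
    not-concurrent on = ℕ.1+n≢0 (begin
      1                      ≡⟨ d≡1 ⟨
      ∣ s - p ℕ.+ q ℕ.+ r ∣  ≡⟨ cong ∣ s -_∣ (lattice-concurrent⇒ s p q r on) ⟩
      ∣ s - s ∣              ≡⟨ ℕ.∣n-n∣≡0 s ⟩
      0                      ∎)
      where open ≡-Reasoning

  ½≤fromℕ[d*d]*½ : ∀ d → d ≢ 0 → ½ ℚ.≤ fromℕ (d ℕ.* d) ℚ.* ½
  ½≤fromℕ[d*d]*½ zero    d≢0 = contradiction refl d≢0
  ½≤fromℕ[d*d]*½ (suc d) _   = ℚ.*-monoʳ-≤-nonNeg ½ (1≤fromℕ-suc (d ℕ.+ d ℕ.* suc d))

  ½≤lattice-area : ∀ s p q r → FormsTriangle (xLine p) (yLine q) (zLine s r) →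
    ½ ℚ.≤ area (xLine p) (yLine q) (zLine s r)
  ½≤lattice-area s p q r (_ , _ , _ , not-concurrent) = subst (½ ℚ.≤_) (sym (lattice-area s p q r))
    (½≤fromℕ[d*d]*½ _ λ d≡0 → not-concurrent (lattice-concurrent⇐ s p q r (sym (ℕ.∣m-n∣≡0⇒m≡n d≡0))))

module Cells where

  open import Data.Nat as ℕ using (zero; suc; _+_; _<_; _≤_; ∣_-_∣; z≤n; s≤s)
  import Data.Nat.Properties as ℕ
  open import Data.Nat.Tactic.RingSolver using (solve-∀)
  open import Data.Product using (proj₁)
  open import Data.List using (List; []; _∷_; _++_; map; length; upTo; cartesianProduct; filter)
  open import Data.List.Properties using (length-map; length-++)
  open import Data.List.Membership.Propositional using (_∈_)
  open import Data.List.Membership.Propositional.Properties using (∈-map⁻; ∈-upTo⁻; ∈-cartesianProduct⁻; ∈-filter⁻)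
  open import Data.List.Relation.Unary.All as All using (All; []; _∷_)
  import Data.List.Relation.Unary.All.Properties as All
  open import Data.List.Relation.Unary.AllPairs using ([]; _∷_)
  open import Data.List.Relation.Unary.Unique.Propositional using (Unique)
  import Data.List.Relation.Unary.Unique.Propositional.Properties as Unique
  open import Relation.Nullary using (¬_)

  Cell : Set
  Cell = ℕ × ℕ × ℕ

  height : Cell → ℕ
  height (p , q , r) = p + q + r

  InBox : ℕ → ℕ → ℕ → Cell → Set
  InBox A B C (p , q , r) = p < A × q < B × r < C

  UnitCell : ℕ → ℕ → ℕ → ℕ → Cell → Set
  UnitCell A B C s c = InBox A B C c × ∣ s - height c ∣ ≡ 1

  record UnitCells (A B C s N : ℕ) : Set where
    field
      cells  : List Cell
      unique : Unique cells
      valid  : All (UnitCell A B C s) cells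
      many   : N ≤ length cells
  open UnitCells public

  unit-above : ∀ {s t} → t ≡ suc s → ∣ s - t ∣ ≡ 1
  unit-above {s} refl = subst (λ m → ∣ s - m ∣ ≡ 1) (ℕ.+-comm s 1) (ℕ.∣m-m+n∣≡n s 1)

  unit-below : ∀ {s t} → suc t ≡ s → ∣ s - t ∣ ≡ 1
  unit-below {t = t} refl = trans (ℕ.∣-∣-comm (suc t) t) (unit-above {t} refl)

  box : ℕ → ℕ → ℕ → List Cell
  box A B C = cartesianProduct (upTo A) (cartesianProduct (upTo B) (upTo C))

  all-unit-cells : ∀ A B C s → UnitCells A B C s (length (filter (λ c → ∣ s - height c ∣ ℕ.≟ 1) (box A B C)))
  all-unit-cells A B C s = record
    { cells  = filter unit? (box A B C)
    ; unique = Unique.filter⁺ unit? (Unique.cartesianProduct⁺ (Unique.upTo⁺ A)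
                 (Unique.cartesianProduct⁺ (Unique.upTo⁺ B) (Unique.upTo⁺ C)))
    ; valid  = All.tabulate λ c∈ → let c∈box , unit = ∈-filter⁻ unit? c∈ in in-box c∈box , unit
    ; many   = ℕ.≤-refl
    }
    where
    unit? = λ c → ∣ s - height c ∣ ℕ.≟ 1
    in-box : ∀ {c} → c ∈ box A B C → InBox A B C c
    in-box {p , q , r} c∈ =
      let p∈ , qr∈ = ∈-cartesianProduct⁻ (upTo A) _ c∈
          q∈ , r∈  = ∈-cartesianProduct⁻ (upTo B) (upTo C) qr∈
      in ∈-upTo⁻ p∈ , ∈-upTo⁻ q∈ , ∈-upTo⁻ r∈

  weaken : ∀ {A B C s M N} → M ≤ N → UnitCells A B C s N → UnitCells A B C s M
  weaken M≤N U = record { cells = cells U ; unique = unique U ; valid = valid U ; many = ℕ.≤-trans M≤N (many U) }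

  rotate-cell : Cell → Cell
  rotate-cell (p , q , r) = (q , r , p)

  rotate : ∀ {A B C s N} → UnitCells A B C s N → UnitCells B C A s N
  rotate {A} {B} {C} {s} {N} U = record
    { cells  = map rotate-cell (cells U)
    ; unique = Unique.map⁺ rotate-injective (unique U)
    ; valid  = All.map⁺ (All.map rotate-valid (valid U))
    ; many   = subst (N ≤_) (sym (length-map rotate-cell (cells U))) (many U)
    }
    where
    rotate-injective : ∀ {c d} → rotate-cell c ≡ rotate-cell d → c ≡ d
    rotate-injective {_ , _ , _} {_ , _ , _} refl = refl
    rotate-height : ∀ p q r → q + r + p ≡ p + q + r
    rotate-height = solve-∀
    rotate-valid : ∀ {c} → UnitCell A B C s c → UnitCell B C A s (rotate-cell c)
    rotate-valid {p , q , r} ((p<A , q<B , r<C) , unit) =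
      (q<B , r<C , p<A) , trans (cong ∣ s -_∣ (rotate-height p q r)) unit

  add-layer : ∀ {A B C s N} a (old : List Cell) (new : List (ℕ × ℕ)) →
    Unique old → All (UnitCell A B C s) old → All (λ c → proj₁ c ≢ a) old → N ≤ length old →
    Unique new → All (λ { (q , r) → UnitCell A B C s (a , q , r) }) new →
    UnitCells A B C s (N + length new)
  add-layer {N = N} a old new unique-old valid-old off-layer N≤old unique-new valid-new = record
    { cells  = old ++ map (a ,_) new
    ; unique = Unique.++⁺ unique-old (Unique.map⁺ (λ { refl → refl }) unique-new) disjoint
    ; valid  = All.++⁺ valid-old (All.map⁺ valid-new)
    ; many   = subst (N + length new ≤_) (sym (trans (length-++ old) (cong (length old +_) (length-map (a ,_) new))))
                 (ℕ.+-monoˡ-≤ (length new) N≤old)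
    }
    where
    disjoint : ∀ {c} → ¬ (c ∈ old × c ∈ map (a ,_) new)
    disjoint (c∈old , c∈new) with ∈-map⁻ (a ,_) c∈new
    ... | _ , _ , refl = All.lookup off-layer c∈old refl

  segment : ℕ → ℕ → ℕ → List (ℕ × ℕ)
  segment q r zero    = []
  segment q r (suc k) = (q , r + k) ∷ segment (suc q) r k

  OnSegment : ℕ → ℕ → ℕ → ℕ × ℕ → Set
  OnSegment q r len (x , y) = q ≤ x × x < q + len × y < r + len × suc (x + y) ≡ q + r + len

  segment-on : ∀ q r len → All (OnSegment q r len) (segment q r len)
  segment-on q r zero    = []
  segment-on q r (suc k) = (ℕ.≤-refl , head-x , head-y , head-level q r k) ∷ All.map shift (segment-on (suc q) r k)
    where
    head-x : q < q + suc k
    head-x = subst (q <_) (sym (ℕ.+-suc q k)) (s≤s (ℕ.m≤m+n q k))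
    head-y : r + k < r + suc k
    head-y = subst (r + k <_) (sym (ℕ.+-suc r k)) ℕ.≤-refl
    head-level : ∀ q r k → suc (q + (r + k)) ≡ q + r + suc k
    head-level = solve-∀
    tail-level : ∀ q r k → suc q + r + k ≡ q + r + suc k
    tail-level = solve-∀
    shift : ∀ {xy} → OnSegment (suc q) r k xy → OnSegment q r (suc k) xy
    shift {x , y} (q<x , x< , y< , level) =
      ℕ.<⇒≤ q<x , subst (x <_) (sym (ℕ.+-suc q k)) x< , subst (y <_) (sym (ℕ.+-suc r k)) (ℕ.m<n⇒m<1+n y<) ,
      trans level (tail-level q r k)

  segment-unique : ∀ q r len → Unique (segment q r len)
  segment-unique q r zero    = []
  segment-unique q r (suc k) =
    All.map (λ { (q<x , _) refl → ℕ.<-irrefl refl q<x }) (segment-on (suc q) r k) ∷ segment-unique (suc q) r k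

  segments-unique : ∀ q r len q′ r′ len′ → q + r + len ≢ q′ + r′ + len′ →
    Unique (segment q r len ++ segment q′ r′ len′)
  segments-unique q r len q′ r′ len′ levels≢ =
    Unique.++⁺ (segment-unique q r len) (segment-unique q′ r′ len′) disjoint
    where
    disjoint : ∀ {xy} → ¬ (xy ∈ segment q r len × xy ∈ segment q′ r′ len′)
    disjoint (xy∈ , xy∈′) =
      let _ , _ , _ , level  = All.lookup (segment-on q r len) xy∈
          _ , _ , _ , level′ = All.lookup (segment-on q′ r′ len′) xy∈′
      in levels≢ (trans (sym level) level′)

  segment-length : ∀ q r len → length (segment q r len) ≡ len
  segment-length q r zero    = refl
  segment-length q r (suc k) = cong suc (segment-length (suc q) r k)

  segments-length : ∀ q r len q′ r′ len′ → length (segment q r len ++ segment q′ r′ len′) ≡ len + len′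
  segments-length q r len q′ r′ len′ =
    trans (length-++ (segment q r len)) (cong₂ _+_ (segment-length q r len) (segment-length q′ r′ len′))

  -- The new layer p = A consists of the antidiagonals q + r = m − 1 and q + r = m + 1 of the
  -- B × C face, of lengths m and m + 2; b and c are the slack of the face beyond m + 2.
  grow-top : ∀ {A B C s N} → UnitCells A B C s N → ∀ m b c → B ≡ 2 + b + m → C ≡ 2 + c + m → A + m ≡ s →
    UnitCells (suc A) B C s (N + (2 + m + m))
  grow-top {A} {B} {C} {s} {N} U m b c refl refl refl =
    subst (UnitCells (suc A) B C s) (cong (N +_) (trans (segments-length 0 0 m 0 0 (2 + m)) (m+[2+m]≡2+m+m m)))
      (add-layer A (cells U) (segment 0 0 m ++ segment 0 0 (2 + m))
        (unique U) (All.map enlarge (valid U)) (All.map off-layer (valid U)) (many U)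
        (segments-unique 0 0 m 0 0 (2 + m) (ℕ.<⇒≢ (ℕ.m<n+m m (s≤s z≤n))))
        (All.++⁺ (All.map lower (segment-on 0 0 m)) (All.map upper (segment-on 0 0 (2 + m)))))
    where
    m+[2+m]≡2+m+m : ∀ m → m + (2 + m) ≡ 2 + m + m
    m+[2+m]≡2+m+m = solve-∀
    2+m≤2+_+m : ∀ n → 2 + m ≤ 2 + n + m
    2+m≤2+_+m n = s≤s (s≤s (ℕ.m≤n+m m n))
    enlarge : ∀ {c} → UnitCell A B C s c → UnitCell (suc A) B C s c
    enlarge {p , q , r} ((p<A , q<B , r<C) , unit) = (ℕ.m<n⇒m<1+n p<A , q<B , r<C) , unit
    off-layer : ∀ {c} → UnitCell A B C s c → proj₁ c ≢ A
    off-layer ((p<A , _) , _) = ℕ.<⇒≢ p<A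
    lower : ∀ {xy} → OnSegment 0 0 m xy → UnitCell (suc A) B C s (A , xy)
    lower {x , y} (_ , x<m , y<m , level) =
      (ℕ.n<1+n A , ℕ.<-≤-trans x<m (ℕ.m≤n+m m (2 + b)) , ℕ.<-≤-trans y<m (ℕ.m≤n+m m (2 + c))) ,
      unit-below (begin
        suc (A + x + y)   ≡⟨ cong suc (ℕ.+-assoc A x y) ⟩
        suc (A + (x + y)) ≡⟨ ℕ.+-suc A (x + y) ⟨
        A + suc (x + y)   ≡⟨ cong (A +_) level ⟩
        A + m             ∎)
      where open ≡-Reasoning
    upper : ∀ {xy} → OnSegment 0 0 (2 + m) xy → UnitCell (suc A) B C s (A , xy)
    upper {x , y} (_ , x< , y< , level) =
      (ℕ.n<1+n A , ℕ.<-≤-trans x< (2+m≤2+_+m b) , ℕ.<-≤-trans y< (2+m≤2+_+m c)) ,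
      unit-above (begin
        A + x + y    ≡⟨ ℕ.+-assoc A x y ⟩
        A + (x + y)  ≡⟨ cong (A +_) (ℕ.suc-injective level) ⟩
        A + suc m    ≡⟨ ℕ.+-suc A m ⟩
        suc (A + m)  ∎)
      where open ≡-Reasoning

  shift-cell : Cell → Cell
  shift-cell (p , q , r) = (suc p , q , r)

  -- The old cells move up by one and the new layer p = 0 consists of the two antidiagonals of the
  -- B × C face farthest from the origin, of lengths m + 2 and m, with sums s and s + 2.
  grow-bottom : ∀ {A B C s N} → UnitCells A B C s N → ∀ m b c → B ≡ 2 + m + b → C ≡ 2 + m + c → suc m + b + c ≡ s →
    UnitCells (suc A) B C (suc s) (N + (2 + m + m))
  grow-bottom {A} {B} {C} {s} {N} U m b c refl refl refl =
    subst (UnitCells (suc A) B C (suc s)) (cong (N +_) (segments-length b c (2 + m) (2 + b) (2 + c) m))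
      (add-layer 0 (map shift-cell (cells U)) (segment b c (2 + m) ++ segment (2 + b) (2 + c) m)
        (Unique.map⁺ shift-injective (unique U))
        (All.map⁺ (All.map shift-valid (valid U)))
        (All.map⁺ (All.tabulate λ {c} _ → off-layer c))
        (subst (N ≤_) (sym (length-map shift-cell (cells U))) (many U))
        (segments-unique b c (2 + m) (2 + b) (2 + c) m levels≢)
        (All.++⁺ (All.map lower (segment-on b c (2 + m))) (All.map upper (segment-on (2 + b) (2 + c) m))))
    where
    lower-level : ∀ m b c → b + c + (2 + m) ≡ suc (suc m + b + c)
    lower-level = solve-∀
    upper-level : ∀ m b c → 2 + b + (2 + c) + m ≡ suc (suc (suc (suc m + b + c)))
    upper-level = solve-∀
    lower-corner : ∀ m b → b + (2 + m) ≡ 2 + m + b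
    lower-corner = solve-∀
    upper-corner : ∀ m b → 2 + b + m ≡ 2 + m + b
    upper-corner = solve-∀
    levels≢ : b + c + (2 + m) ≢ 2 + b + (2 + c) + m
    levels≢ eq = ℕ.<⇒≢ (ℕ.m<n+m (suc m + b + c) {2} (s≤s z≤n))
      (ℕ.suc-injective (trans (sym (lower-level m b c)) (trans eq (upper-level m b c))))
    shift-injective : ∀ {c d} → shift-cell c ≡ shift-cell d → c ≡ d
    shift-injective {_ , _ , _} {_ , _ , _} refl = refl
    shift-valid : ∀ {c} → UnitCell A B C s c → UnitCell (suc A) B C (suc s) (shift-cell c)
    shift-valid {_ , _ , _} ((p<A , q<B , r<C) , unit) = (s≤s p<A , q<B , r<C) , unit
    off-layer : ∀ c → proj₁ (shift-cell c) ≢ 0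
    off-layer (_ , _ , _) ()
    lower : ∀ {xy} → OnSegment b c (2 + m) xy → UnitCell (suc A) B C (suc s) (0 , xy)
    lower {x , y} (_ , x< , y< , level) =
      (s≤s z≤n , subst (x <_) (lower-corner m b) x< , subst (y <_) (lower-corner m c) y<) ,
      unit-below (trans level (lower-level m b c))
    upper : ∀ {xy} → OnSegment (2 + b) (2 + c) m xy → UnitCell (suc A) B C (suc s) (0 , xy)
    upper {x , y} (_ , x< , y< , level) =
      (s≤s z≤n , subst (x <_) (upper-corner m b) x< , subst (y <_) (upper-corner m c) y<) ,
      unit-above (ℕ.suc-injective (trans level (upper-level m b c)))

module Arrangement where

  open Lattice
  open Cells
  open import Data.Nat as ℕ using (zero; suc; _+_; _<_; _≤_; z≤n; s≤s)
  import Data.Nat.Properties as ℕ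
  open import Data.Integer as ℤ using ()
  open import Data.Rational as ℚ using (½)
  open import Data.Fin as Fin using (Fin; toℕ; fromℕ<)
  import Data.Fin.Properties as Fin
  open import Data.Product using (proj₁; proj₂)
  open import Data.List using (length)
  open import Data.List.Relation.Unary.All as All using (All; []; _∷_)
  open import Data.List.Relation.Unary.AllPairs using ([]; _∷_)
  open import Data.List.Relation.Unary.Unique.Propositional using (Unique)
  open import Function using (_∘_)
  open import Relation.Nullary using (contradiction)

  data Slot (A B C : ℕ) : ℕ → Set where
    x-slot : ∀ {p} → p < A → Slot A B C p
    y-slot : ∀ {q} → q < B → Slot A B C (A + q)
    z-slot : ∀ {r} → r < C → Slot A B C (A + B + r)

  slot : ∀ A B C {k} → k < A + B + C → Slot A B C k
  slot (suc A) B C {zero}  _         = x-slot (s≤s z≤n)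
  slot (suc A) B C {suc k} (s≤s k<n) with slot A B C k<n
  ... | x-slot p<A = x-slot (s≤s p<A)
  ... | y-slot q<B = y-slot q<B
  ... | z-slot r<C = z-slot r<C
  slot zero (suc B) C {zero}  _         = y-slot (s≤s z≤n)
  slot zero (suc B) C {suc k} (s≤s k<n) with slot zero B C k<n
  ... | y-slot q<B = y-slot (s≤s q<B)
  ... | z-slot r<C = z-slot r<C
  slot zero zero C k<C = z-slot k<C

  slot-bound : ∀ {A B C k} → Slot A B C k → k < A + B + C
  slot-bound {A} {B} {C} (x-slot p<A) = ℕ.<-≤-trans p<A (ℕ.≤-trans (ℕ.m≤m+n A B) (ℕ.m≤m+n (A + B) C))
  slot-bound {A} {B} {C} (y-slot q<B) = ℕ.<-≤-trans (ℕ.+-monoʳ-< A q<B) (ℕ.m≤m+n (A + B) C)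
  slot-bound {A} {B}     (z-slot r<C) = ℕ.+-monoʳ-< (A + B) r<C

  rank : ∀ {A B C k} → Slot A B C k → ℕ
  rank (x-slot _) = 0
  rank (y-slot _) = 1
  rank (z-slot _) = 2

  rank-monotone : ∀ {A B C i j} (u : Slot A B C i) (v : Slot A B C j) → i ≤ j → rank u ≤ rank v
  rank-monotone (x-slot _) _ _ = z≤n
  rank-monotone (y-slot _) (y-slot _) _ = ℕ.≤-refl
  rank-monotone (y-slot _) (z-slot _) _ = s≤s z≤n
  rank-monotone (z-slot _) (z-slot _) _ = ℕ.≤-refl
  rank-monotone {A} (y-slot {q} _) (x-slot p<A) i≤j =
    contradiction (ℕ.≤-<-trans i≤j p<A) (ℕ.m+n≮m A q)
  rank-monotone {A} {B} (z-slot {r} _) (x-slot p<A) i≤j =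
    contradiction (ℕ.≤-<-trans i≤j (ℕ.<-≤-trans p<A (ℕ.m≤m+n A B))) (ℕ.m+n≮m (A + B) r)
  rank-monotone {A} {B} (z-slot {r} _) (y-slot q<B) i≤j =
    contradiction (ℕ.≤-<-trans i≤j (ℕ.+-monoʳ-< A q<B)) (ℕ.m+n≮m (A + B) r)

  lineOf : ∀ {A B C k} → ℕ → Slot A B C k → Line
  lineOf s (x-slot {p} _) = xLine p
  lineOf s (y-slot {q} _) = yLine q
  lineOf s (z-slot {r} _) = zLine s r

  lineOf-unique : ∀ {A B C i j} s (u : Slot A B C i) (v : Slot A B C j) → i ≡ j → lineOf s u ≡ lineOf s v
  lineOf-unique s (x-slot _) (x-slot _) eq = cong xLine eq
  lineOf-unique {A} s (y-slot _) (y-slot _) eq = cong yLine (ℕ.+-cancelˡ-≡ A _ _ eq)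
  lineOf-unique {A} {B} s (z-slot _) (z-slot _) eq = cong (zLine s) (ℕ.+-cancelˡ-≡ (A + B) _ _ eq)
  lineOf-unique s u@(x-slot _) v@(y-slot _) eq = contradiction (rank-monotone v u (ℕ.≤-reflexive (sym eq))) λ ()
  lineOf-unique s u@(x-slot _) v@(z-slot _) eq = contradiction (rank-monotone v u (ℕ.≤-reflexive (sym eq))) λ ()
  lineOf-unique s u@(y-slot _) v@(z-slot _) eq = contradiction (rank-monotone v u (ℕ.≤-reflexive (sym eq))) λ { (s≤s ()) }
  lineOf-unique s u@(y-slot _) v@(x-slot _) eq = contradiction (rank-monotone u v (ℕ.≤-reflexive eq)) λ ()
  lineOf-unique s u@(z-slot _) v@(x-slot _) eq = contradiction (rank-monotone u v (ℕ.≤-reflexive eq)) λ ()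
  lineOf-unique s u@(z-slot _) v@(y-slot _) eq = contradiction (rank-monotone u v (ℕ.≤-reflexive eq)) λ { (s≤s ()) }

  lineOf-injective : ∀ {A B C i j} s (u : Slot A B C i) (v : Slot A B C j) → SameLine (lineOf s u) (lineOf s v) → i ≡ j
  lineOf-injective s (x-slot _) (x-slot _) same = xLine-injective same
  lineOf-injective {A} s (y-slot _) (y-slot _) same = cong (A +_) (yLine-injective same)
  lineOf-injective {A} {B} s (z-slot _) (z-slot _) same = cong (A + B +_) (zLine-injective {s} same)
  lineOf-injective s u@(x-slot _) v@(y-slot _) same = contradiction (same-line⇒parallel (lineOf s u) (lineOf s v) same) λ ()
  lineOf-injective s u@(x-slot _) v@(z-slot _) same = contradiction (same-line⇒parallel (lineOf s u) (lineOf s v) same) λ ()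
  lineOf-injective s u@(y-slot _) v@(x-slot _) same = contradiction (same-line⇒parallel (lineOf s u) (lineOf s v) same) λ ()
  lineOf-injective s u@(y-slot _) v@(z-slot _) same = contradiction (same-line⇒parallel (lineOf s u) (lineOf s v) same) λ ()
  lineOf-injective s u@(z-slot _) v@(x-slot _) same = contradiction (same-line⇒parallel (lineOf s u) (lineOf s v) same) λ ()
  lineOf-injective s u@(z-slot _) v@(y-slot _) same = contradiction (same-line⇒parallel (lineOf s u) (lineOf s v) same) λ ()

  -- With increasing indices, pairwise non-parallel lines must be one vertical, one horizontal and
  -- one antidiagonal line, in this order.
  ½≤slot-area : ∀ {A B C i j k} s (u : Slot A B C i) (v : Slot A B C j) (w : Slot A B C k) → i < j → j < k →
    FormsTriangle (lineOf s u) (lineOf s v) (lineOf s w) → ½ ℚ.≤ area (lineOf s u) (lineOf s v) (lineOf s w)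
  ½≤slot-area s (x-slot {p} _) (y-slot {q} _) (z-slot {r} _) _ _ T = ½≤lattice-area s p q r T
  ½≤slot-area s (x-slot _) (x-slot _) _ _ _ (∦ , _) = contradiction refl ∦
  ½≤slot-area s (y-slot _) (y-slot _) _ _ _ (∦ , _) = contradiction refl ∦
  ½≤slot-area s (z-slot _) (z-slot _) _ _ _ (∦ , _) = contradiction refl ∦
  ½≤slot-area s _ (x-slot _) (x-slot _) _ _ (_ , ∦ , _) = contradiction refl ∦
  ½≤slot-area s _ (y-slot _) (y-slot _) _ _ (_ , ∦ , _) = contradiction refl ∦
  ½≤slot-area s _ (z-slot _) (z-slot _) _ _ (_ , ∦ , _) = contradiction refl ∦
  ½≤slot-area s u@(y-slot _) v@(x-slot _) _ i<j _ _ = contradiction (rank-monotone u v (ℕ.<⇒≤ i<j)) λ ()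
  ½≤slot-area s u@(z-slot _) v@(x-slot _) _ i<j _ _ = contradiction (rank-monotone u v (ℕ.<⇒≤ i<j)) λ ()
  ½≤slot-area s u@(z-slot _) v@(y-slot _) _ i<j _ _ = contradiction (rank-monotone u v (ℕ.<⇒≤ i<j)) λ { (s≤s ()) }
  ½≤slot-area s (x-slot _) v@(y-slot _) w@(x-slot _) _ j<k _ = contradiction (rank-monotone v w (ℕ.<⇒≤ j<k)) λ ()
  ½≤slot-area s (x-slot _) v@(z-slot _) w@(x-slot _) _ j<k _ = contradiction (rank-monotone v w (ℕ.<⇒≤ j<k)) λ ()
  ½≤slot-area s (x-slot _) v@(z-slot _) w@(y-slot _) _ j<k _ = contradiction (rank-monotone v w (ℕ.<⇒≤ j<k)) λ { (s≤s ()) }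
  ½≤slot-area s (y-slot _) v@(z-slot _) w@(x-slot _) _ j<k _ = contradiction (rank-monotone v w (ℕ.<⇒≤ j<k)) λ ()
  ½≤slot-area s (y-slot _) v@(z-slot _) w@(y-slot _) _ j<k _ = contradiction (rank-monotone v w (ℕ.<⇒≤ j<k)) λ { (s≤s ()) }

  transport-triangle : ∀ {l₁ l₂ l₃ m₁ m₂ m₃} → l₁ ≡ m₁ → l₂ ≡ m₂ → l₃ ≡ m₃ →
    FormsTriangle m₁ m₂ m₃ × area m₁ m₂ m₃ ≡ ½ → FormsTriangle l₁ l₂ l₃ × area l₁ l₂ l₃ ≡ ½
  transport-triangle refl refl refl t = t

  module _ {X Y : Set} {P : X → Set} (f : ∀ {x} → P x → Y) where

    reduce-length : ∀ {xs} (pxs : All P xs) → length (All.reduce f pxs) ≡ length xs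
    reduce-length []        = refl
    reduce-length (_ ∷ pxs) = cong suc (reduce-length pxs)

    reduce-all : ∀ {Q : Y → Set} {R : X → Set} → (∀ {x} (px : P x) → R x → Q (f px)) →
      ∀ {xs} (pxs : All P xs) → All R xs → All Q (All.reduce f pxs)
    reduce-all g []         []         = []
    reduce-all g (px ∷ pxs) (rx ∷ rxs) = g px rx ∷ reduce-all g pxs rxs

    reduce-unique : (∀ {x y} (px : P x) (py : P y) → f px ≡ f py → x ≡ y) →
      ∀ {xs} (pxs : All P xs) → Unique xs → Unique (All.reduce f pxs)
    reduce-unique inj []         []         = []
    reduce-unique inj (px ∷ pxs) (x∉ ∷ uxs) =
      reduce-all (λ py x≢y fx≡fy → x≢y (inj px py fx≡fy)) pxs x∉ ∷ reduce-unique inj pxs uxs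

  module _ {A B C s : ℕ} where

    slotOf : (i : Fin (A + B + C)) → Slot A B C (toℕ i)
    slotOf i = slot A B C (Fin.toℕ<n i)

    lattice : Arrangement (A + B + C)
    lattice i = lineOf s (slotOf i)

    lattice-distinct : Distinct lattice
    lattice-distinct i j i≢j same = i≢j (Fin.toℕ-injective (lineOf-injective s (slotOf i) (slotOf j) same))

    index : ∀ {k} → Slot A B C k → Fin (A + B + C)
    index v = fromℕ< (slot-bound v)

    toℕ-index : ∀ {k} (v : Slot A B C k) → toℕ (index v) ≡ k
    toℕ-index v = Fin.toℕ-fromℕ< (slot-bound v)

    index-injective : ∀ {k k′} (v : Slot A B C k) (w : Slot A B C k′) → index v ≡ index w → k ≡ k′
    index-injective v w eq = trans (sym (toℕ-index v)) (trans (cong toℕ eq) (toℕ-index w))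

    lattice-index : ∀ {k} (v : Slot A B C k) → lattice (index v) ≡ lineOf s v
    lattice-index v = lineOf-unique s (slotOf (index v)) v (toℕ-index v)

    triple : ∀ {c} → UnitCell A B C s c → Triple (A + B + C)
    triple ((p<A , q<B , r<C) , _) = index (x-slot p<A) , index (y-slot q<B) , index (z-slot r<C)

    triple-injective : ∀ {c d} (u : UnitCell A B C s c) (v : UnitCell A B C s d) → triple u ≡ triple v → c ≡ d
    triple-injective ((p<A , q<B , r<C) , _) ((p′<A , q′<B , r′<C) , _) eq =
      cong₂ _,_ (index-injective (x-slot p<A) (x-slot p′<A) (cong proj₁ eq))
        (cong₂ _,_ (ℕ.+-cancelˡ-≡ A _ _ (index-injective (y-slot q<B) (y-slot q′<B) (cong (proj₁ ∘ proj₂) eq)))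
                   (ℕ.+-cancelˡ-≡ (A + B) _ _ (index-injective (z-slot r<C) (z-slot r′<C) (cong (proj₂ ∘ proj₂) eq))))

    triple-minimal : ∀ {c} (u : UnitCell A B C s c) → IsMinTriangle lattice (triple u)
    triple-minimal {p , q , r} ((p<A , q<B , r<C) , unit) =
      (increasing₁ , increasing₂) , proj₁ unit-triangle′ ,
      λ { (i , j , k) (i<j , j<k) T → subst (ℚ._≤ _) (sym (proj₂ unit-triangle′))
            (½≤slot-area s (slotOf i) (slotOf j) (slotOf k) i<j j<k T) }
      where
      unit-triangle′ = transport-triangle (lattice-index (x-slot p<A)) (lattice-index (y-slot q<B)) (lattice-index (z-slot r<C))
        (unit-triangle s p q r unit)
      increasing₁ : index (x-slot p<A) Fin.< index (y-slot q<B)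
      increasing₁ = subst₂ _<_ (sym (toℕ-index (x-slot p<A))) (sym (toℕ-index (y-slot q<B)))
        (ℕ.<-≤-trans p<A (ℕ.m≤m+n A q))
      increasing₂ : index (y-slot q<B) Fin.< index (z-slot r<C)
      increasing₂ = subst₂ _<_ (sym (toℕ-index (y-slot q<B))) (sym (toℕ-index (z-slot r<C)))
        (ℕ.<-≤-trans (ℕ.+-monoʳ-< A q<B) (ℕ.m≤m+n (A + B) r))

    realise : ∀ {N} → UnitCells A B C s N → m≥ (A + B + C) (ℤ.+ N)
    realise {N} U = lattice , lattice-distinct , All.reduce triple (valid U) ,
      reduce-unique triple triple-injective (valid U) (unique U) ,
      reduce-all triple (λ u _ → triple-minimal u) (valid U) (valid U) ,
      ℤ.+≤+ (subst (N ≤_) (sym (reduce-length triple (valid U))) (many U))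

module Hexagons where

  open Cells
  open Arrangement using (realise)
  open import Data.Nat as ℕ using (zero; suc; _+_; _*_; z≤n)
  import Data.Nat.Properties as ℕ
  open import Data.Nat.Tactic.RingSolver using (solve-∀)
  open import Data.Integer as ℤ using ()

  Hexagon : ℕ → Set
  Hexagon l = UnitCells (1 + (l + l)) (1 + (l + l)) (1 + (l + l)) (l + l + l) (6 * (l * l) + 6 * l)

  realise-as : ∀ {A B C s N n} → A + B + C ≡ n → UnitCells A B C s N → m≥ n (ℤ.+ N)
  realise-as refl = realise

  box-size : ∀ x y z l → x + (l + l) + (y + (l + l)) + (z + (l + l)) ≡ 6 * l + (x + y + z)
  box-size = solve-∀

  hexagon-arrangement : ∀ l → Hexagon l → m≥ (6 * l + 3) (ℤ.+ (6 * (l * l) + 6 * l))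
  hexagon-arrangement l = realise-as (box-size 1 1 1 l)

  record Cycle (l : ℕ) : Set where
    field
      size-6l+4 : m≥ (6 * l + 4) (ℤ.+ (6 * (l * l) + 8 * l + 0))
      size-6l+5 : m≥ (6 * l + 5) (ℤ.+ (6 * (l * l) + 10 * l + 2))
      size-6l+6 : m≥ (6 * l + 6) (ℤ.+ (6 * (l * l) + 12 * l + 4))
      size-6l+7 : m≥ (6 * l + 7) (ℤ.+ (6 * (l * l) + 14 * l + 6))
      size-6l+8 : m≥ (6 * l + 8) (ℤ.+ (6 * (l * l) + 16 * l + 8))
      next      : Hexagon (suc l)

  first-cycle : Cycle 0
  first-cycle = record
    { size-6l+4 = realise (weaken z≤n (all-unit-cells 1 1 2 1))
    ; size-6l+5 = realise (all-unit-cells 1 2 2 1)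
    ; size-6l+6 = realise (all-unit-cells 2 2 2 2)
    ; size-6l+7 = realise (all-unit-cells 2 2 3 2)
    ; size-6l+8 = realise (all-unit-cells 2 3 3 3)
    ; next      = all-unit-cells 3 3 3 3
    }

  count-first : ∀ k → 6 * (suc k * suc k) + 6 * suc k + (2 + k + k) ≡ 6 * (suc k * suc k) + 8 * suc k + 0
  count-first = solve-∀

  count-step : ∀ a b l → 6 * (l * l) + a * l + b + (2 + l + l) ≡ 6 * (l * l) + (2 + a) * l + (2 + b)
  count-step = solve-∀

  count-last : ∀ l → 6 * (l * l) + 16 * l + 8 + (2 + suc l + suc l) ≡ 6 * (suc l * suc l) + 6 * suc l
  count-last = solve-∀

  height-last : ∀ l → 3 + (l + l + l) ≡ suc l + suc l + suc l
  height-last = solve-∀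

  side : ∀ l → 3 + (l + l) ≡ 2 + l + suc l
  side l = cong (2 +_) (sym (ℕ.+-suc l l))

  module _ (k : ℕ) (start : Hexagon (suc k)) where
    private
      l = suc k

    stage₁ : UnitCells (1 + (l + l)) (1 + (l + l)) (2 + (l + l)) (1 + (l + l + l)) (6 * (l * l) + 8 * l + 0)
    stage₁ = subst (UnitCells _ _ _ _) (count-first k) (rotate (grow-bottom start k l l refl refl refl))

    stage₂ : UnitCells (1 + (l + l)) (2 + (l + l)) (2 + (l + l)) (1 + (l + l + l)) (6 * (l * l) + 10 * l + 2)
    stage₂ = subst (UnitCells _ _ _ _) (count-step 8 0 l) (rotate (grow-top stage₁ l k l refl refl refl))

    stage₃ : UnitCells (2 + (l + l)) (2 + (l + l)) (2 + (l + l)) (2 + (l + l + l)) (6 * (l * l) + 12 * l + 4)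
    stage₃ = subst (UnitCells _ _ _ _) (count-step 10 2 l) (rotate (grow-bottom stage₂ l l l refl refl refl))

    stage₄ : UnitCells (2 + (l + l)) (2 + (l + l)) (3 + (l + l)) (2 + (l + l + l)) (6 * (l * l) + 14 * l + 6)
    stage₄ = subst (UnitCells _ _ _ _) (count-step 12 4 l) (rotate (grow-top stage₃ l l l refl refl refl))

    stage₅ : UnitCells (2 + (l + l)) (3 + (l + l)) (3 + (l + l)) (3 + (l + l + l)) (6 * (l * l) + 16 * l + 8)
    stage₅ = subst (UnitCells _ _ _ _) (count-step 14 6 l)
      (rotate (grow-bottom stage₄ l l (suc l) refl (side l) (cong suc (ℕ.+-suc (l + l) l))))

    stage₆ : Hexagon (suc l)
    stage₆ = subst₂ (λ a h → UnitCells a a a h (6 * (suc l * suc l) + 6 * suc l)) (side l) (height-last l)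
      (subst (UnitCells _ _ _ _) (count-last l)
        (rotate (grow-top stage₅ (suc l) l l (side l) (side l) (cong (2 +_) (ℕ.+-suc (l + l) l)))))

    later-cycle : Cycle l
    later-cycle = record
      { size-6l+4 = realise-as (box-size 1 1 2 l) stage₁
      ; size-6l+5 = realise-as (box-size 1 2 2 l) stage₂
      ; size-6l+6 = realise-as (box-size 2 2 2 l) stage₃
      ; size-6l+7 = realise-as (box-size 2 2 3 l) stage₄
      ; size-6l+8 = realise-as (box-size 2 3 3 l) stage₅
      ; next      = stage₆
      }

  cycle : ∀ l → Cycle l
  hexagon : ∀ l → Hexagon l

  cycle zero    = first-cycle
  cycle (suc k) = later-cycle k (hexagon (suc k))

  hexagon zero    = all-unit-cells 1 1 1 0
  hexagon (suc l) = Cycle.next (cycle l)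

open Hexagons using (cycle; hexagon; hexagon-arrangement)
open Hexagons.Cycle
open import Data.Nat as ℕ using (zero; suc; _≥_; z≤n)
import Data.Nat.Properties as ℕ
open import Data.Integer using (ℤ; +_; -[1+_]; _+_; _-_; _*_; -_; -≤-; -≤+; +≤+)
import Data.Integer as ℤ
import Data.Integer.Properties as ℤ
import Data.Integer.Tactic.RingSolver as ℤ-Solver
open import Data.Product using (∃)
open import Data.Sum using (_⊎_; inj₁; inj₂)
open import Relation.Nullary using (contradiction)

pos-linear : ∀ a k c → + (a ℕ.* k ℕ.+ c) ≡ + a * + k + + c
pos-linear a k c = trans (ℤ.pos-+ (a ℕ.* k) c) (cong (_+ + c) (ℤ.pos-* a k))

pos-quadratic : ∀ a b k → + (a ℕ.* (k ℕ.* k) ℕ.+ b ℕ.* k) ≡ + a * (+ k * + k) + + b * + k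
pos-quadratic a b k = trans (ℤ.pos-+ (a ℕ.* (k ℕ.* k)) (b ℕ.* k))
  (cong₂ _+_ (trans (ℤ.pos-* a (k ℕ.* k)) (cong (+ a *_) (ℤ.pos-* k k))) (ℤ.pos-* b k))

nonpositive-multiplier : ∀ {n} l j → l ℤ.≤ + 0 → j ℤ.≤ + 2 → + n ≡ + 6 * l + j → n ℕ.≤ 2
nonpositive-multiplier {n} l j l≤0 j≤2 eq = ℤ.drop‿+≤+ (begin
  + n            ≡⟨ eq ⟩
  + 6 * l + j    ≤⟨ ℤ.+-monoˡ-≤ j (ℤ.*-monoˡ-≤-nonNeg (+ 6) l≤0) ⟩
  + 0 + j        ≡⟨ ℤ.+-identityˡ j ⟩
  j              ≤⟨ j≤2 ⟩
  + 2            ∎)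
  where open ℤ.≤-Reasoning

multiplier-positive : ∀ {n} l j → 3 ℕ.≤ n → j ℤ.≤ + 2 → + n ≡ + 6 * l + j → ∃ λ k → l ≡ + suc k
multiplier-positive (+ suc k) _ _ _ _  = k , refl
multiplier-positive (+ zero)  j 3≤n j≤2 eq = contradiction (nonpositive-multiplier (+ 0) j (+≤+ z≤n) j≤2 eq) (ℕ.<⇒≱ 3≤n)
multiplier-positive -[1+ k ]  j 3≤n j≤2 eq = contradiction (nonpositive-multiplier -[1+ k ] j -≤+ j≤2 eq) (ℕ.<⇒≱ 3≤n)

multiplier-nonnegative : ∀ {n} l → + n ≡ + 6 * l + + 3 → ∃ λ k → l ≡ + k
multiplier-nonnegative (+ k)    _  = k , refl
multiplier-nonnegative -[1+ k ] eq = contradiction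
  (subst (ℤ._≤ + 6 * -[1+ 0 ] + + 3) (sym eq) (ℤ.+-monoˡ-≤ (+ 3) (ℤ.*-monoˡ-≤-nonNeg (+ 6) (-≤- {m = k} z≤n)))) λ ()

-- n = 6 (k + 1) + j written as 6 k + c, and the bound as 6 k² + a k + b, with c, a, b ∈ ℕ.
near-hexagonal : ∀ {n} k j c a b → + c ≡ + 6 + j → + a ≡ + 12 + + 2 * j → + b ≡ + 4 + + 2 * j →
  m≥ (6 ℕ.* k ℕ.+ c) (+ (6 ℕ.* (k ℕ.* k) ℕ.+ a ℕ.* k ℕ.+ b)) →
  + n ≡ + 6 * + suc k + j → m≥ n (+ 6 * + suc k * + suc k + + 2 * j * + suc k - + 2)
near-hexagonal {n} k j c a b c≡ a≡ b≡ arrangement eq = subst₂ m≥ size≡ count≡ arrangement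
  where
  open ≡-Reasoning
  shift : ∀ K j → + 6 * K + (+ 6 + j) ≡ + 6 * (+ 1 + K) + j
  shift = ℤ-Solver.solve-∀
  expand : ∀ K j → + 6 * (K * K) + (+ 12 + + 2 * j) * K + (+ 4 + + 2 * j)
                 ≡ + 6 * (+ 1 + K) * (+ 1 + K) + + 2 * j * (+ 1 + K) - + 2
  expand = ℤ-Solver.solve-∀
  size≡ : 6 ℕ.* k ℕ.+ c ≡ n
  size≡ = ℤ.+-injective (begin
    + (6 ℕ.* k ℕ.+ c)       ≡⟨ pos-linear 6 k c ⟩
    + 6 * + k + + c          ≡⟨ cong (λ x → + 6 * + k + x) c≡ ⟩
    + 6 * + k + (+ 6 + j)    ≡⟨ shift (+ k) j ⟩
    + 6 * + suc k + j        ≡⟨ eq ⟨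
    + n                      ∎)
  count≡ : + (6 ℕ.* (k ℕ.* k) ℕ.+ a ℕ.* k ℕ.+ b) ≡ + 6 * + suc k * + suc k + + 2 * j * + suc k - + 2
  count≡ = begin
    + (6 ℕ.* (k ℕ.* k) ℕ.+ a ℕ.* k ℕ.+ b)            ≡⟨ ℤ.pos-+ (6 ℕ.* (k ℕ.* k) ℕ.+ a ℕ.* k) b ⟩
    + (6 ℕ.* (k ℕ.* k) ℕ.+ a ℕ.* k) + + b            ≡⟨ cong₂ _+_ (pos-quadratic 6 a k) b≡ ⟩
    + 6 * (+ k * + k) + + a * + k + (+ 4 + + 2 * j)  ≡⟨ cong (λ x → + 6 * (+ k * + k) + x * + k + (+ 4 + + 2 * j)) a≡ ⟩
    + 6 * (+ k * + k) + (+ 12 + + 2 * j) * + k + (+ 4 + + 2 * j)  ≡⟨ expand (+ k) j ⟩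
    + 6 * + suc k * + suc k + + 2 * j * + suc k - + 2  ∎

hexagonal : ∀ {n} k → + n ≡ + 6 * + k + + 3 → m≥ n (+ 6 * + k * + k + + 6 * + k)
hexagonal {n} k eq = subst₂ m≥ size≡ count≡ (hexagon-arrangement k (hexagon k))
  where
  size≡ : 6 ℕ.* k ℕ.+ 3 ≡ n
  size≡ = ℤ.+-injective (trans (pos-linear 6 k 3) (sym eq))
  count≡ : + (6 ℕ.* (k ℕ.* k) ℕ.+ 6 ℕ.* k) ≡ + 6 * + k * + k + + 6 * + k
  count≡ = trans (pos-quadratic 6 6 k) (cong (_+ + 6 * + k) (sym (ℤ.*-assoc (+ 6) (+ k) (+ k))))

Residue : ℤ → Set
Residue j = j ≡ + 0 ⊎ j ≡ + 1 ⊎ j ≡ - + 1 ⊎ j ≡ + 2 ⊎ j ≡ - + 2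

residue≤2 : ∀ {j} → Residue j → j ℤ.≤ + 2
residue≤2 (inj₁ refl)                      = +≤+ z≤n
residue≤2 (inj₂ (inj₁ refl))               = +≤+ (ℕ.s≤s z≤n)
residue≤2 (inj₂ (inj₂ (inj₁ refl)))        = -≤+
residue≤2 (inj₂ (inj₂ (inj₂ (inj₁ refl)))) = ℤ.≤-refl
residue≤2 (inj₂ (inj₂ (inj₂ (inj₂ refl)))) = -≤+

near-hexagonal-residue : ∀ {n} k {j} → Residue j →
  + n ≡ + 6 * + suc k + j → m≥ n (+ 6 * + suc k * + suc k + + 2 * j * + suc k - + 2)
near-hexagonal-residue k (inj₁ refl)                      = near-hexagonal k (+ 0) 6 12 4 refl refl refl (size-6l+6 (cycle k))
near-hexagonal-residue k (inj₂ (inj₁ refl))               = near-hexagonal k (+ 1) 7 14 6 refl refl refl (size-6l+7 (cycle k))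
near-hexagonal-residue k (inj₂ (inj₂ (inj₁ refl)))        = near-hexagonal k (- + 1) 5 10 2 refl refl refl (size-6l+5 (cycle k))
near-hexagonal-residue k (inj₂ (inj₂ (inj₂ (inj₁ refl)))) = near-hexagonal k (+ 2) 8 16 8 refl refl refl (size-6l+8 (cycle k))
near-hexagonal-residue k (inj₂ (inj₂ (inj₂ (inj₂ refl)))) = near-hexagonal k (- + 2) 4 8 0 refl refl refl (size-6l+4 (cycle k))

proposition4 : (n : ℕ) → n ≥ 3 →
    ((l j : ℤ) → (j ≡ + 0 ⊎ j ≡ + 1 ⊎ j ≡ - + 1 ⊎ j ≡ + 2 ⊎ j ≡ - + 2) →
      + n ≡ + 6 * l + j →
      m≥ n (+ 6 * l * l + + 2 * j * l - + 2))
    × ((l : ℤ) → + n ≡ + 6 * l + + 3 → m≥ n (+ 6 * l * l + + 6 * l))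
proposition4 n n≥3 = near-hexagonal-sizes , hexagonal-sizes
  where
  near-hexagonal-sizes : ∀ l j → Residue j → + n ≡ + 6 * l + j → m≥ n (+ 6 * l * l + + 2 * j * l - + 2)
  near-hexagonal-sizes l j residue eq with multiplier-positive l j n≥3 (residue≤2 residue) eq
  ... | k , refl = near-hexagonal-residue k residue eq
  hexagonal-sizes : ∀ l → + n ≡ + 6 * l + + 3 → m≥ n (+ 6 * l * l + + 6 * l)
  hexagonal-sizes l eq with multiplier-nonnegative l eq
  ... | k , refl = hexagonal k eq
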